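{- Let $M$ be a program. The abstract alternating machine $\mathcal{K}_{\mathcal{B}}$ accepts $M$ if and only if the $\beta\delta$-normal form of $M$ is $T$.
   Context: $\Lambda_B$ terms: $t,u,v::=x\mid F\mid T\mid \lambda x.t\mid t\,u\mid \mathrm{if}\ t\ \mathrm{then}\ u\ \mathrm{else}\ v$, with $\beta$-reduction and $\delta$-reduction (contextual closure of $(\mathrm{if}\ T\ \mathrm{then}\ u\ \mathrm{else}\ v)\to u$, $(\mathrm{if}\ F\ \mathrm{then}\ u\ \mathrm{else}\ v)\to v$). Types of $\mathbf{DLAL_B}$: $A,B::=\alpha\mid A\multimap B\mid A\Rightarrow B\mid \S A\mid \forall\alpha.A\mid \mathbf{Bool}$, judgements $\Gamma;\Delta\vdash t:A$ ($\Gamma$ non-linear, $\Delta$ linear variable declarations, disjoint). Rules: (Id) $;x:A\vdash x:A$. ($\multimap$i) from $\Gamma;\Delta,x:A\vdash t:B$ infer $\Gamma;\Delta\vdash\lambda x.t:A\multimap B$. ($\multimap$e) from $\Gamma_1;\Delta_1\vdash t:A\multimap B$ and $\Gamma_2;\Delta_2\vdash u:A$ infer $\Gamma_1,\Gamma_2;\Delta_1,\Delta_2\vdash t\,u:B$. ($\Rightarrow$i) from $\Gamma,x:A;\Delta\vdash t:B$ infer $\Gamma;\Delta\vdash \lambda x.t:A\Rightarrow B$. ($\Rightarrow$e) from $\Gamma;\Delta\vdash t:A\Rightarrow B$ and $;z:C\vdash u:A$ infer $\Gamma,z:C;\Delta\vdash t\,u:B$ (right premise may also be $;\vdash u:A$,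 conclusion $\Gamma;\Delta\vdash t\,u:B$). (Weak) from $\Gamma_1;\Delta_1\vdash t:A$ infer $\Gamma_1,\Gamma_2;\Delta_1,\Delta_2\vdash t:A$. (Cntr) from $x_1:A,x_2:A,\Gamma;\Delta\vdash t:B$ infer $x:A,\Gamma;\Delta\vdash t[x/x_1,x/x_2]:B$. ($\S$i) from $;\Gamma,\Delta\vdash t:A$ infer $\Gamma;\S\Delta\vdash t:\S A$. ($\S$e) from $\Gamma_1;\Delta_1\vdash u:\S A$ and $\Gamma_2;x:\S A,\Delta_2\vdash t:B$ infer $\Gamma_1,\Gamma_2;\Delta_1,\Delta_2\vdash t[u/x]:B$. ($\forall$i) from $\Gamma;\Delta\vdash t:A$ infer $\Gamma;\Delta\vdash t:\forall\alpha.A$ if $\alpha$ not free in $\Gamma,\Delta$. ($\forall$e) from $\Gamma;\Delta\vdash t:\forall\alpha.A$ infer $\Gamma;\Delta\vdash t:A[B/\alpha]$. ($B_0$i) $;\vdash F:\mathbf{Bool}$; ($B_1$i) $;\vdash T:\mathbf{Bool}$. ($B$e) from $\Gamma;\Delta\vdash M_0:\S^k\mathbf{Bool}$, $\Gamma;\Delta\vdash M_1:A$, $\Gamma;\Delta\vdash M_2:A$ infer $\Gamma;\Delta\vdash \mathrm{if}\ M_0\ \mathrm{then}\ M_1\ \mathrm{else}\ M_2:A$. A program is a term $M$ with $;\vdash M:\S^n\mathbf{Bool}$ for some $n\in\mathbb{N}$ (it has a unique $\beta\delta$-normal form). Machine $\mathcal{K}_{\mathcal{B}}$. A context $\mathcal{A}$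 is a finite sequence of assignments $x_i:=t_i$ with distinct $x_i$; $\emptyset$ is the empty one and $@$ denotes concatenation. Configurations: $[\![\mathrm{Rejecting}]\!]$, $[\![\mathrm{Accepting}]\!]$, existential $[\![(\exists)\,\mathcal{A}\mid\{b;t\}]\!]$ and universal $[\![(\forall)\,\mathcal{A}\mid\{b;t\}\{b';t'\}]\!]$ with $b,b'\in\{yes,no\}$. Every term is uniquely $N_0N_1\cdots N_p$ with $N_0$ a variable, abstraction, if-term or constant. Transitions: ($\beta$) $[\![(\exists)\mathcal{A}\mid\{b;(\lambda x.N)N_1\cdots N_p\}]\!]\to[\![(\exists)\mathcal{A}@(x':=N_1)\mid\{b;N[x'/x]N_2\cdots N_p\}]\!]$, $x'$ fresh; ($h$) $[\![(\exists)\mathcal{A}_1@(x:=N)@\mathcal{A}_2\mid\{b;x N_1\cdots N_p\}]\!]\to[\![(\exists)\mathcal{A}_1@(x:=N)@\mathcal{A}_2\mid\{b;N N_1\cdots N_p\}]\!]$; ($if$) $[\![(\exists)\mathcal{A}\mid\{b;(\mathrm{if}\ M_0\ \mathrm{then}\ M_1\ \mathrm{else}\ M_2)N_1\cdots N_p\}]\!]$ has successors $[\![(\forall)\mathcal{A}\mid\{yes;M_0\}\{b;M_1N_1\cdots N_p\}]\!]$ and $[\![(\forall)\mathcal{A}\mid\{no;M_0\}\{b;M_2N_1\cdots N_p\}]\!]$; ($if'$) $[\![(\forall)\mathcal{A}\mid\{a;M_0\}\{b;N\}]\!]$ has successors $[\![(\exists)\mathcal{A}\mid\{a;M_0\}]\!]$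 and $[\![(\exists)\mathcal{A}\mid\{b;N\}]\!]$; base cases: $[\![(\exists)\mathcal{A}\mid\{yes;T\}]\!]$, $[\![(\exists)\mathcal{A}\mid\{no;F\}]\!]\to[\![\mathrm{Accepting}]\!]$ and $[\![(\exists)\mathcal{A}\mid\{no;T\}]\!]$, $[\![(\exists)\mathcal{A}\mid\{yes;F\}]\!]\to[\![\mathrm{Rejecting}]\!]$. Initial configuration on input $M$: $[\![(\exists)\emptyset\mid\{yes;M\}]\!]$; acceptance is as for alternating Turing machines (existential: some successor accepted; universal: all successors accepted; Accepting accepted, Rejecting not), and $\mathcal{K}_{\mathcal{B}}$ accepts $M$ iff the initial configuration is accepted. -}

module Defs where

open import Data.Nat using (ℕ; zero; suc; _∸_; _<ᵇ_; _≡ᵇ_)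
open import Data.Bool using (if_then_else_)
open import Data.List using (List; []; _∷_; _++_; map)
open import Data.Product using (_×_; _,_; proj₁; proj₂; Σ)
open import Data.Empty using (⊥)
open import Relation.Nullary using (¬_)
open import Relation.Binary.PropositionalEquality using (_≡_)
open import Data.List.Membership.Propositional using (_∉_)
open import Data.List.Relation.Unary.All using (All)
open import Data.List.Relation.Unary.Unique.Propositional using (Unique)
open import Data.List.Relation.Binary.Permutation.Propositional using (_↭_)
open import Relation.Binary.Construct.Closure.ReflexiveTransitive using (Star)

-- Terms of Λ_B.  Bound variables are de Bruijn indices (bvar); free
-- (named) variables are fvar x, x : ℕ.  tt = T, ff = F.

data Term : Set where
  bvar : ℕ → Term
  fvar : ℕ → Term
  ff   : Term
  tt   : Term
  lam  : Term → Term
  app  : Term → Term → Term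
  ite  : Term → Term → Term → Term

shift : ℕ → Term → Term
shift c (bvar n) = if n <ᵇ c then bvar n else bvar (suc n)
shift c (fvar x) = fvar x
shift c ff = ff
shift c tt = tt
shift c (lam t) = lam (shift (suc c) t)
shift c (app t u) = app (shift c t) (shift c u)
shift c (ite t u v) = ite (shift c t) (shift c u) (shift c v)

-- capture-avoiding substitution of u for de Bruijn index j
-- (indices above j are decremented, as the binder disappears)
sub : ℕ → Term → Term → Term
sub j u (bvar n) = if n ≡ᵇ j then u else (if j <ᵇ n then bvar (n ∸ 1) else bvar n)
sub j u (fvar x) = fvar x
sub j u ff = ff
sub j u tt = tt
sub j u (lam t) = lam (sub (suc j) (shift 0 u) t)
sub j u (app t t') = app (sub j u t) (sub j u t')
sub j u (ite t t' t'') = ite (sub j u t) (sub j u t') (sub j u t'')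

fsub : ℕ → Term → Term → Term
fsub x u (bvar n) = bvar n
fsub x u (fvar y) = if x ≡ᵇ y then u else fvar y
fsub x u ff = ff
fsub x u tt = tt
fsub x u (lam t) = lam (fsub x (shift 0 u) t)
fsub x u (app t t') = app (fsub x u t) (fsub x u t')
fsub x u (ite t t' t'') = ite (fsub x u t) (fsub x u t') (fsub x u t'')

fv : Term → List ℕ
fv (bvar n) = []
fv (fvar x) = x ∷ []
fv ff = []
fv tt = []
fv (lam t) = fv t
fv (app t u) = fv t ++ fv u
fv (ite t u v) = fv t ++ fv u ++ fv v

infix 4 _⟶_ _⟶*_
data _⟶_ : Term → Term → Set where
  β     : ∀ {t u} → app (lam t) u ⟶ sub 0 u t
  δT    : ∀ {u v} → ite tt u v ⟶ u
  δF    : ∀ {u v} → ite ff u v ⟶ v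
  ξlam  : ∀ {t t'} → t ⟶ t' → lam t ⟶ lam t'
  ξappl : ∀ {t t' u} → t ⟶ t' → app t u ⟶ app t' u
  ξappr : ∀ {t u u'} → u ⟶ u' → app t u ⟶ app t u'
  ξite₀ : ∀ {t t' u v} → t ⟶ t' → ite t u v ⟶ ite t' u v
  ξite₁ : ∀ {t u u' v} → u ⟶ u' → ite t u v ⟶ ite t u' v
  ξite₂ : ∀ {t u v v'} → v ⟶ v' → ite t u v ⟶ ite t u v'

_⟶*_ : Term → Term → Set
_⟶*_ = Star _⟶_

Normal : Term → Set
Normal t = ∀ u → ¬ (t ⟶ u)

IsNormalFormOf : Term → Term → Set
IsNormalFormOf n t = (t ⟶* n) × Normal n

-- Types of DLAL_B (type variables as de Bruijn indices)

data Ty : Set where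
  tvar : ℕ → Ty
  _⊸_  : Ty → Ty → Ty
  _⇒_  : Ty → Ty → Ty
  §    : Ty → Ty
  ∀'   : Ty → Ty
  𝔹    : Ty

tshift : ℕ → Ty → Ty
tshift c (tvar n) = if n <ᵇ c then tvar n else tvar (suc n)
tshift c (A ⊸ B) = tshift c A ⊸ tshift c B
tshift c (A ⇒ B) = tshift c A ⇒ tshift c B
tshift c (§ A) = § (tshift c A)
tshift c (∀' A) = ∀' (tshift (suc c) A)
tshift c 𝔹 = 𝔹

tsub : ℕ → Ty → Ty → Ty
tsub j B (tvar n) = if n ≡ᵇ j then B else (if j <ᵇ n then tvar (n ∸ 1) else tvar n)
tsub j B (A ⊸ A') = tsub j B A ⊸ tsub j B A'
tsub j B (A ⇒ A') = tsub j B A ⇒ tsub j B A'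
tsub j B (§ A) = § (tsub j B A)
tsub j B (∀' A) = ∀' (tsub (suc j) (tshift 0 B) A)
tsub j B 𝔹 = 𝔹

§^ : ℕ → Ty → Ty
§^ zero A = A
§^ (suc k) A = § (§^ k A)

-- typing contexts: lists of declarations x : A (order irrelevant, see Exch)
Ctx : Set
Ctx = List (ℕ × Ty)

dom : Ctx → List ℕ
dom = map proj₁

WF : Ctx → Ctx → Set
WF Γ Δ = Unique (dom (Γ ++ Δ))

shiftCtx : Ctx → Ctx
shiftCtx = map (λ p → proj₁ p , tshift 0 (proj₂ p))

§Ctx : Ctx → Ctx
§Ctx = map (λ p → proj₁ p , § (proj₂ p))

infix 3 _︔_⊢_∶_
data _︔_⊢_∶_ : Ctx → Ctx → Term → Ty → Set where
  Id    : ∀ {x A} → [] ︔ (x , A) ∷ [] ⊢ fvar x ∶ A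
  Exch  : ∀ {Γ Γ' Δ Δ' t A} → Γ ↭ Γ' → Δ ↭ Δ' → Γ ︔ Δ ⊢ t ∶ A → Γ' ︔ Δ' ⊢ t ∶ A
  ⊸i    : ∀ {Γ Δ x t A B} → x ∉ fv t →
          Γ ︔ Δ ++ (x , A) ∷ [] ⊢ sub 0 (fvar x) t ∶ B → Γ ︔ Δ ⊢ lam t ∶ A ⊸ B
  ⊸e    : ∀ {Γ₁ Γ₂ Δ₁ Δ₂ t u A B} → Γ₁ ︔ Δ₁ ⊢ t ∶ A ⊸ B → Γ₂ ︔ Δ₂ ⊢ u ∶ A →
          WF (Γ₁ ++ Γ₂) (Δ₁ ++ Δ₂) → Γ₁ ++ Γ₂ ︔ Δ₁ ++ Δ₂ ⊢ app t u ∶ B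
  ⇒i    : ∀ {Γ Δ x t A B} → x ∉ fv t →
          Γ ++ (x , A) ∷ [] ︔ Δ ⊢ sub 0 (fvar x) t ∶ B → Γ ︔ Δ ⊢ lam t ∶ A ⇒ B
  ⇒e    : ∀ {Γ Δ z C t u A B} → Γ ︔ Δ ⊢ t ∶ A ⇒ B → [] ︔ (z , C) ∷ [] ⊢ u ∶ A →
          WF (Γ ++ (z , C) ∷ []) Δ → Γ ++ (z , C) ∷ [] ︔ Δ ⊢ app t u ∶ B
  ⇒e₀   : ∀ {Γ Δ t u A B} → Γ ︔ Δ ⊢ t ∶ A ⇒ B → [] ︔ [] ⊢ u ∶ A →
          Γ ︔ Δ ⊢ app t u ∶ B
  Weak  : ∀ {Γ₁ Γ₂ Δ₁ Δ₂ t A} → Γ₁ ︔ Δ₁ ⊢ t ∶ A → WF (Γ₁ ++ Γ₂) (Δ₁ ++ Δ₂) →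
          Γ₁ ++ Γ₂ ︔ Δ₁ ++ Δ₂ ⊢ t ∶ A
  Cntr  : ∀ {x x₁ x₂ Γ Δ t A B} → (x₁ , A) ∷ (x₂ , A) ∷ Γ ︔ Δ ⊢ t ∶ B →
          WF ((x , A) ∷ Γ) Δ →
          (x , A) ∷ Γ ︔ Δ ⊢ fsub x₁ (fvar x) (fsub x₂ (fvar x) t) ∶ B
  §i    : ∀ {Γ Δ t A} → [] ︔ Γ ++ Δ ⊢ t ∶ A → Γ ︔ §Ctx Δ ⊢ t ∶ § A
  §e    : ∀ {Γ₁ Γ₂ Δ₁ Δ₂ x u t A B} → Γ₁ ︔ Δ₁ ⊢ u ∶ § A →
          Γ₂ ︔ (x , § A) ∷ Δ₂ ⊢ t ∶ B → WF (Γ₁ ++ Γ₂) (Δ₁ ++ Δ₂) →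
          Γ₁ ++ Γ₂ ︔ Δ₁ ++ Δ₂ ⊢ fsub x u t ∶ B
  -- "α not free in Γ,Δ": in de Bruijn form, the contexts are shifted
  ∀i    : ∀ {Γ Δ t A} → shiftCtx Γ ︔ shiftCtx Δ ⊢ t ∶ A → Γ ︔ Δ ⊢ t ∶ ∀' A
  ∀e    : ∀ {Γ Δ t A B} → Γ ︔ Δ ⊢ t ∶ ∀' A → Γ ︔ Δ ⊢ t ∶ tsub 0 B A
  B₀i   : [] ︔ [] ⊢ ff ∶ 𝔹
  B₁i   : [] ︔ [] ⊢ tt ∶ 𝔹
  Be    : ∀ {Γ Δ k M₀ M₁ M₂ A} → Γ ︔ Δ ⊢ M₀ ∶ §^ k 𝔹 → Γ ︔ Δ ⊢ M₁ ∶ A →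
          Γ ︔ Δ ⊢ M₂ ∶ A → Γ ︔ Δ ⊢ ite M₀ M₁ M₂ ∶ A

Program : Term → Set
Program M = Σ ℕ (λ n → [] ︔ [] ⊢ M ∶ §^ n 𝔹)

data Ans : Set where
  yes no : Ans

-- contexts of assignments x := t
MCtx : Set
MCtx = List (ℕ × Term)

data Conf : Set where
  Rejecting Accepting : Conf
  ∃⟦_∣_⸴_⟧ : MCtx → Ans → Term → Conf
  ∀⟦_∣_⸴_∣_⸴_⟧ : MCtx → Ans → Term → Ans → Term → Conf

apps : Term → List Term → Term
apps t [] = t
apps t (u ∷ us) = apps (app t u) us

Fresh : ℕ → MCtx → Term → Set
Fresh x 𝒜 t = (x ∉ map proj₁ 𝒜) × (x ∉ fv t) × All (λ p → x ∉ fv (proj₂ p)) 𝒜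

infix 3 _↦_
data _↦_ : Conf → Conf → Set where
  tβ   : ∀ {𝒜 b N N₁ Ns x'} → Fresh x' 𝒜 (apps (lam N) (N₁ ∷ Ns)) →
         ∃⟦ 𝒜 ∣ b ⸴ apps (lam N) (N₁ ∷ Ns) ⟧ ↦
         ∃⟦ 𝒜 ++ (x' , N₁) ∷ [] ∣ b ⸴ apps (sub 0 (fvar x') N) Ns ⟧
  th   : ∀ {𝒜₁ 𝒜₂ x N b Ns} →
         ∃⟦ 𝒜₁ ++ (x , N) ∷ 𝒜₂ ∣ b ⸴ apps (fvar x) Ns ⟧ ↦
         ∃⟦ 𝒜₁ ++ (x , N) ∷ 𝒜₂ ∣ b ⸴ apps N Ns ⟧
  tif₁ : ∀ {𝒜 b M₀ M₁ M₂ Ns} →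
         ∃⟦ 𝒜 ∣ b ⸴ apps (ite M₀ M₁ M₂) Ns ⟧ ↦ ∀⟦ 𝒜 ∣ yes ⸴ M₀ ∣ b ⸴ apps M₁ Ns ⟧
  tif₂ : ∀ {𝒜 b M₀ M₁ M₂ Ns} →
         ∃⟦ 𝒜 ∣ b ⸴ apps (ite M₀ M₁ M₂) Ns ⟧ ↦ ∀⟦ 𝒜 ∣ no ⸴ M₀ ∣ b ⸴ apps M₂ Ns ⟧
  tif'₁ : ∀ {𝒜 a M₀ b N} → ∀⟦ 𝒜 ∣ a ⸴ M₀ ∣ b ⸴ N ⟧ ↦ ∃⟦ 𝒜 ∣ a ⸴ M₀ ⟧
  tif'₂ : ∀ {𝒜 a M₀ b N} → ∀⟦ 𝒜 ∣ a ⸴ M₀ ∣ b ⸴ N ⟧ ↦ ∃⟦ 𝒜 ∣ b ⸴ N ⟧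
  tyT  : ∀ {𝒜} → ∃⟦ 𝒜 ∣ yes ⸴ tt ⟧ ↦ Accepting
  tnF  : ∀ {𝒜} → ∃⟦ 𝒜 ∣ no ⸴ ff ⟧ ↦ Accepting
  tnT  : ∀ {𝒜} → ∃⟦ 𝒜 ∣ no ⸴ tt ⟧ ↦ Rejecting
  tyF  : ∀ {𝒜} → ∃⟦ 𝒜 ∣ yes ⸴ ff ⟧ ↦ Rejecting

-- acceptance as for alternating machines (least fixed point)
data Accepted : Conf → Set where
  acc : Accepted Accepting
  exi : ∀ {𝒜 b t c'} → ∃⟦ 𝒜 ∣ b ⸴ t ⟧ ↦ c' → Accepted c' → Accepted ∃⟦ 𝒜 ∣ b ⸴ t ⟧
  uni : ∀ {𝒜 a M b N} → (∀ c' → ∀⟦ 𝒜 ∣ a ⸴ M ∣ b ⸴ N ⟧ ↦ c' → Accepted c') →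
        Accepted ∀⟦ 𝒜 ∣ a ⸴ M ∣ b ⸴ N ⟧

initial : Term → Conf
initial M = ∃⟦ [] ∣ yes ⸴ M ⟧

KB-accepts : Term → Set
KB-accepts M = Accepted (initial M)

module Submission where

-- Reduction and the machine are linked through head evaluation to a boolean,
-- `Eval n b t Ns`: t applied to the stack Ns head-evaluates to the answer b.
--  * Substitution: `shift`, `sub` and `fsub` are instances of a simultaneous
--    substitution `sbst`, whose composition laws give the substitution lemma.
--  * Standardisation: Takahashi's factorisation of parallel reduction into
--    head steps followed by an internal step shows that `Eval` is closed under
--    βδ-expansion; so M ⟶* T yields an evaluation of M, and conversely every
--    evaluation is read back as a reduction sequence to T.
--  * Unfolding: a machine state 𝒜 ∣ t denotes `unf 𝒜 t`, the term with the
--    assignments of 𝒜 substituted; each transition is one head-evaluation step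
--    (or none) on denotations.
--  * Soundness (induction on acceptance) and completeness (induction on the
--    measure n of an evaluation, plus well-founded lookup through 𝒜) follow.

open import Defs
open import Function.Bundles using (_⇔_; mk⇔; Equivalence)
open import Function using (_∘_)
open import Data.Nat using (ℕ; zero; suc; _∸_; _⊔_; _<_; s≤s; z≤n; _<ᵇ_; _≡ᵇ_)
open import Data.Nat.Properties using (_≟_; n≮n; m⊔n<o⇒m<o; m⊔n<o⇒n<o; ≤-refl; ≡ᵇ⇒≡; ≡⇒≡ᵇ)
open import Data.Nat.Induction using (<-wellFounded)
open import Induction.WellFounded using (Acc; acc)
open import Data.Bool using (true; false; if_then_else_)
open import Data.Bool.Properties using (T-≡; ¬-not)
open import Data.List using (List; []; _∷_; _++_; map; length; drop)
open import Data.List.Properties using (++-identityʳ; map-++; map-cong-local; drop-all)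
open import Data.List.Membership.Propositional using (_∈_; _∉_)
open import Data.List.Membership.DecPropositional _≟_ using (_∈?_)
open import Data.List.Membership.Propositional.Properties using (∈-++⁺ˡ; ∈-++⁺ʳ; ∈-++⁻; ∈-map⁺; ∈-map⁻; ∈-∃++)
open import Data.List.Relation.Unary.Any using (here; there)
open import Data.List.Relation.Unary.All as All using (All; []; _∷_)
open import Data.List.Extrema.Nat using (max; xs≤max)
open import Data.Product using (Σ; _×_; _,_; proj₁; proj₂)
open import Data.Sum using (_⊎_; inj₁; inj₂; [_,_])
open import Data.Unit using (⊤)
open import Data.Empty using (⊥; ⊥-elim)
open import Relation.Nullary using () renaming (yes to dyes; no to dno)
open import Relation.Binary.PropositionalEquality
  using (_≡_; _≢_; refl; sym; trans; cong; cong₂; subst; subst₂; _≗_; module ≡-Reasoning)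
open import Relation.Binary.Construct.Closure.ReflexiveTransitive using (Star; ε; _◅_; _◅◅_; gmap)

cong₃ : {A B C D : Set} (f : A → B → C → D) {a a' : A} {b b' : B} {c c' : C} →
        a ≡ a' → b ≡ b' → c ≡ c' → f a b c ≡ f a' b' c'
cong₃ f refl refl refl = refl

-- De Bruijn substitution, and its relation to the operations of the definitions.
module Substitution where

  ext : (ℕ → ℕ) → ℕ → ℕ
  ext ρ zero = zero
  ext ρ (suc n) = suc (ρ n)

  ren : (ℕ → ℕ) → Term → Term
  ren ρ (bvar n) = bvar (ρ n)
  ren ρ (fvar x) = fvar x
  ren ρ ff = ff
  ren ρ tt = tt
  ren ρ (lam t) = lam (ren (ext ρ) t)
  ren ρ (app t u) = app (ren ρ t) (ren ρ u)
  ren ρ (ite t u v) = ite (ren ρ t) (ren ρ u) (ren ρ v)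

  exts : (ℕ → Term) → ℕ → Term
  exts σ zero = bvar zero
  exts σ (suc n) = ren suc (σ n)

  sbst : (ℕ → Term) → (ℕ → Term) → Term → Term
  sbst σ φ (bvar n) = σ n
  sbst σ φ (fvar x) = φ x
  sbst σ φ ff = ff
  sbst σ φ tt = tt
  sbst σ φ (lam t) = lam (sbst (exts σ) (ren suc ∘ φ) t)
  sbst σ φ (app t u) = app (sbst σ φ t) (sbst σ φ u)
  sbst σ φ (ite t u v) = ite (sbst σ φ t) (sbst σ φ u) (sbst σ φ v)

  ren-cong : ∀ {ρ ρ'} → ρ ≗ ρ' → ∀ t → ren ρ t ≡ ren ρ' t
  ren-cong e (bvar n) = cong bvar (e n)
  ren-cong e (fvar x) = refl
  ren-cong e ff = refl
  ren-cong e tt = refl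
  ren-cong e (lam t) = cong lam (ren-cong ext-cong t)
    where
    ext-cong : ext _ ≗ ext _
    ext-cong zero = refl
    ext-cong (suc n) = cong suc (e n)
  ren-cong e (app t u) = cong₂ app (ren-cong e t) (ren-cong e u)
  ren-cong e (ite t u v) = cong₃ ite (ren-cong e t) (ren-cong e u) (ren-cong e v)

  sbst-cong : ∀ {σ σ' φ φ'} → σ ≗ σ' → φ ≗ φ' → ∀ t → sbst σ φ t ≡ sbst σ' φ' t
  sbst-cong e f (bvar n) = e n
  sbst-cong e f (fvar x) = f x
  sbst-cong e f ff = refl
  sbst-cong e f tt = refl
  sbst-cong e f (lam t) = cong lam (sbst-cong exts-cong (cong (ren suc) ∘ f) t)
    where
    exts-cong : exts _ ≗ exts _
    exts-cong zero = refl
    exts-cong (suc n) = cong (ren suc) (e n)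
  sbst-cong e f (app t u) = cong₂ app (sbst-cong e f t) (sbst-cong e f u)
  sbst-cong e f (ite t u v) = cong₃ ite (sbst-cong e f t) (sbst-cong e f u) (sbst-cong e f v)

  ren-ren : ∀ ρ ρ' t → ren ρ (ren ρ' t) ≡ ren (ρ ∘ ρ') t
  ren-ren ρ ρ' (bvar n) = refl
  ren-ren ρ ρ' (fvar x) = refl
  ren-ren ρ ρ' ff = refl
  ren-ren ρ ρ' tt = refl
  ren-ren ρ ρ' (lam t) = cong lam (trans (ren-ren (ext ρ) (ext ρ') t) (ren-cong ext-∘ t))
    where
    ext-∘ : ext ρ ∘ ext ρ' ≗ ext (ρ ∘ ρ')
    ext-∘ zero = refl
    ext-∘ (suc n) = refl
  ren-ren ρ ρ' (app t u) = cong₂ app (ren-ren ρ ρ' t) (ren-ren ρ ρ' u)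
  ren-ren ρ ρ' (ite t u v) = cong₃ ite (ren-ren ρ ρ' t) (ren-ren ρ ρ' u) (ren-ren ρ ρ' v)

  ren-ext-suc : ∀ ρ u → ren (ext ρ) (ren suc u) ≡ ren suc (ren ρ u)
  ren-ext-suc ρ u = trans (ren-ren (ext ρ) suc u) (sym (ren-ren suc ρ u))

  ren-sbst : ∀ ρ σ φ t → ren ρ (sbst σ φ t) ≡ sbst (ren ρ ∘ σ) (ren ρ ∘ φ) t
  ren-sbst ρ σ φ (bvar n) = refl
  ren-sbst ρ σ φ (fvar x) = refl
  ren-sbst ρ σ φ ff = refl
  ren-sbst ρ σ φ tt = refl
  ren-sbst ρ σ φ (lam t) =
    cong lam (trans (ren-sbst (ext ρ) (exts σ) _ t) (sbst-cong ren-exts (ren-ext-suc ρ ∘ φ) t))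
    where
    ren-exts : ren (ext ρ) ∘ exts σ ≗ exts (ren ρ ∘ σ)
    ren-exts zero = refl
    ren-exts (suc n) = ren-ext-suc ρ (σ n)
  ren-sbst ρ σ φ (app t u) = cong₂ app (ren-sbst ρ σ φ t) (ren-sbst ρ σ φ u)
  ren-sbst ρ σ φ (ite t u v) = cong₃ ite (ren-sbst ρ σ φ t) (ren-sbst ρ σ φ u) (ren-sbst ρ σ φ v)

  sbst-ren : ∀ σ φ ρ t → sbst σ φ (ren ρ t) ≡ sbst (σ ∘ ρ) φ t
  sbst-ren σ φ ρ (bvar n) = refl
  sbst-ren σ φ ρ (fvar x) = refl
  sbst-ren σ φ ρ ff = refl
  sbst-ren σ φ ρ tt = refl
  sbst-ren σ φ ρ (lam t) =
    cong lam (trans (sbst-ren (exts σ) _ (ext ρ) t) (sbst-cong exts-ext (λ _ → refl) t))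
    where
    exts-ext : exts σ ∘ ext ρ ≗ exts (σ ∘ ρ)
    exts-ext zero = refl
    exts-ext (suc n) = refl
  sbst-ren σ φ ρ (app t u) = cong₂ app (sbst-ren σ φ ρ t) (sbst-ren σ φ ρ u)
  sbst-ren σ φ ρ (ite t u v) = cong₃ ite (sbst-ren σ φ ρ t) (sbst-ren σ φ ρ u) (sbst-ren σ φ ρ v)

  sbst-lift-suc : ∀ τ ψ u → sbst (exts τ) (ren suc ∘ ψ) (ren suc u) ≡ ren suc (sbst τ ψ u)
  sbst-lift-suc τ ψ u = trans (sbst-ren (exts τ) _ suc u) (sym (ren-sbst suc τ ψ u))

  sbst-sbst : ∀ τ ψ σ φ t → sbst τ ψ (sbst σ φ t) ≡ sbst (sbst τ ψ ∘ σ) (sbst τ ψ ∘ φ) t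
  sbst-sbst τ ψ σ φ (bvar n) = refl
  sbst-sbst τ ψ σ φ (fvar x) = refl
  sbst-sbst τ ψ σ φ ff = refl
  sbst-sbst τ ψ σ φ tt = refl
  sbst-sbst τ ψ σ φ (lam t) =
    cong lam (trans (sbst-sbst (exts τ) _ (exts σ) _ t) (sbst-cong sbst-exts (sbst-lift-suc τ ψ ∘ φ) t))
    where
    sbst-exts : sbst (exts τ) (ren suc ∘ ψ) ∘ exts σ ≗ exts (sbst τ ψ ∘ σ)
    sbst-exts zero = refl
    sbst-exts (suc n) = sbst-lift-suc τ ψ (σ n)
  sbst-sbst τ ψ σ φ (app t u) = cong₂ app (sbst-sbst τ ψ σ φ t) (sbst-sbst τ ψ σ φ u)
  sbst-sbst τ ψ σ φ (ite t u v) =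
    cong₃ ite (sbst-sbst τ ψ σ φ t) (sbst-sbst τ ψ σ φ u) (sbst-sbst τ ψ σ φ v)

  exts-bvar : ∀ ρ → exts (bvar ∘ ρ) ≗ bvar ∘ ext ρ
  exts-bvar ρ zero = refl
  exts-bvar ρ (suc n) = refl

  ren-as-sbst : ∀ ρ t → ren ρ t ≡ sbst (bvar ∘ ρ) fvar t
  ren-as-sbst ρ (bvar n) = refl
  ren-as-sbst ρ (fvar x) = refl
  ren-as-sbst ρ ff = refl
  ren-as-sbst ρ tt = refl
  ren-as-sbst ρ (lam t) =
    cong lam (trans (ren-as-sbst (ext ρ) t) (sym (sbst-cong (exts-bvar ρ) (λ _ → refl) t)))
  ren-as-sbst ρ (app t u) = cong₂ app (ren-as-sbst ρ t) (ren-as-sbst ρ u)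
  ren-as-sbst ρ (ite t u v) = cong₃ ite (ren-as-sbst ρ t) (ren-as-sbst ρ u) (ren-as-sbst ρ v)

  sbst-id : ∀ t → sbst bvar fvar t ≡ t
  sbst-id (bvar n) = refl
  sbst-id (fvar x) = refl
  sbst-id ff = refl
  sbst-id tt = refl
  sbst-id (lam t) = cong lam (trans (sbst-cong exts-id (λ _ → refl) t) (sbst-id t))
    where
    exts-id : exts bvar ≗ bvar
    exts-id zero = refl
    exts-id (suc n) = refl
  sbst-id (app t u) = cong₂ app (sbst-id t) (sbst-id u)
  sbst-id (ite t u v) = cong₃ ite (sbst-id t) (sbst-id u) (sbst-id v)

  σ0 : Term → ℕ → Term
  σ0 u zero = u
  σ0 u (suc n) = bvar n

  sub0 : Term → Term → Term
  sub0 u = sbst (σ0 u) fvar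

  sub0-cancel : ∀ v t → sub0 v (ren suc t) ≡ t
  sub0-cancel v t = trans (sbst-ren (σ0 v) fvar suc t) (sbst-id t)

  sub0-sbst : ∀ σ φ u t → sbst σ φ (sub0 u t) ≡ sub0 (sbst σ φ u) (sbst (exts σ) (ren suc ∘ φ) t)
  sub0-sbst σ φ u t = begin
    sbst σ φ (sub0 u t)                                  ≡⟨ sbst-sbst σ φ (σ0 u) fvar t ⟩
    sbst (sbst σ φ ∘ σ0 u) φ t                           ≡⟨ sbst-cong bound (sym ∘ sub0-cancel _ ∘ φ) t ⟩
    sbst (sub0 u' ∘ exts σ) (sub0 u' ∘ (ren suc ∘ φ)) t  ≡⟨ sym (sbst-sbst (σ0 u') fvar (exts σ) _ t) ⟩
    sub0 u' (sbst (exts σ) (ren suc ∘ φ) t)              ∎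
    where
    open ≡-Reasoning
    u' = sbst σ φ u
    bound : sbst σ φ ∘ σ0 u ≗ sub0 u' ∘ exts σ
    bound zero = refl
    bound (suc n) = sym (sub0-cancel u' (σ n))

  ren-sub0 : ∀ ρ u t → ren ρ (sub0 u t) ≡ sub0 (ren ρ u) (ren (ext ρ) t)
  ren-sub0 ρ u t = begin
    ren ρ (sub0 u t)                                            ≡⟨ ren-as-sbst ρ (sub0 u t) ⟩
    sbst (bvar ∘ ρ) fvar (sub0 u t)                             ≡⟨ sub0-sbst (bvar ∘ ρ) fvar u t ⟩
    sub0 (sbst (bvar ∘ ρ) fvar u) (sbst (exts (bvar ∘ ρ)) fvar t)
      ≡⟨ cong₂ sub0 (sym (ren-as-sbst ρ u)) (sbst-cong (exts-bvar ρ) (λ _ → refl) t) ⟩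
    sub0 (ren ρ u) (sbst (bvar ∘ ext ρ) fvar t)
      ≡⟨ cong (sub0 (ren ρ u)) (sym (ren-as-sbst (ext ρ) t)) ⟩
    sub0 (ren ρ u) (ren (ext ρ) t)                              ∎
    where open ≡-Reasoning

  shiftρ : ℕ → ℕ → ℕ
  shiftρ c n = if n <ᵇ c then n else suc n

  shift-ren : ∀ c t → shift c t ≡ ren (shiftρ c) t
  shift-ren c (bvar n) with n <ᵇ c
  ... | true = refl
  ... | false = refl
  shift-ren c (fvar x) = refl
  shift-ren c ff = refl
  shift-ren c tt = refl
  shift-ren c (lam t) = cong lam (trans (shift-ren (suc c) t) (ren-cong shiftρ-suc t))
    where
    shiftρ-suc : shiftρ (suc c) ≗ ext (shiftρ c)
    shiftρ-suc zero = refl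
    shiftρ-suc (suc n) with n <ᵇ c
    ... | true = refl
    ... | false = refl
  shift-ren c (app t u) = cong₂ app (shift-ren c t) (shift-ren c u)
  shift-ren c (ite t u v) = cong₃ ite (shift-ren c t) (shift-ren c u) (shift-ren c v)

  shift0 : ∀ t → shift 0 t ≡ ren suc t
  shift0 t = shift-ren 0 t

  subσ : ℕ → Term → ℕ → Term
  subσ j u n = if n ≡ᵇ j then u else (if j <ᵇ n then bvar (n ∸ 1) else bvar n)

  sub-sbst : ∀ j u t → sub j u t ≡ sbst (subσ j u) fvar t
  sub-sbst j u (bvar n) = refl
  sub-sbst j u (fvar x) = refl
  sub-sbst j u ff = refl
  sub-sbst j u tt = refl
  sub-sbst j u (lam t) =
    cong lam (trans (sub-sbst (suc j) (shift 0 u) t) (sbst-cong subσ-suc (λ _ → refl) t))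
    where
    subσ-suc : subσ (suc j) (shift 0 u) ≗ exts (subσ j u)
    subσ-suc zero = refl
    subσ-suc (suc m) with m ≡ᵇ j
    ... | true = shift0 u
    ... | false with m
    ... | zero = refl
    ... | suc m' with j <ᵇ suc m'
    ... | true = refl
    ... | false = refl
  sub-sbst j u (app t t') = cong₂ app (sub-sbst j u t) (sub-sbst j u t')
  sub-sbst j u (ite t t' t'') = cong₃ ite (sub-sbst j u t) (sub-sbst j u t') (sub-sbst j u t'')

  sub0-eq : ∀ u t → sub 0 u t ≡ sub0 u t
  sub0-eq u t = trans (sub-sbst 0 u t) (sbst-cong subσ-0 (λ _ → refl) t)
    where
    subσ-0 : subσ 0 u ≗ σ0 u
    subσ-0 zero = refl
    subσ-0 (suc n) = refl

  fsubφ : ℕ → Term → ℕ → Term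
  fsubφ x u y = if x ≡ᵇ y then u else fvar y

  fsubφ-shift : ∀ x u → fsubφ x (shift 0 u) ≗ ren suc ∘ fsubφ x u
  fsubφ-shift x u y with x ≡ᵇ y
  ... | true = shift0 u
  ... | false = refl

  fsub-sbst : ∀ x u t → fsub x u t ≡ sbst bvar (fsubφ x u) t
  fsub-sbst x u (bvar n) = refl
  fsub-sbst x u (fvar y) = refl
  fsub-sbst x u ff = refl
  fsub-sbst x u tt = refl
  fsub-sbst x u (lam t) =
    cong lam (trans (fsub-sbst x (shift 0 u) t)
                    (sbst-cong (λ { zero → refl ; (suc n) → refl }) (fsubφ-shift x u) t))
  fsub-sbst x u (app t t') = cong₂ app (fsub-sbst x u t) (fsub-sbst x u t')
  fsub-sbst x u (ite t t' t'') = cong₃ ite (fsub-sbst x u t) (fsub-sbst x u t') (fsub-sbst x u t'')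

  fsub-sub0 : ∀ x N v t → fsub x N (sub 0 v t) ≡ sub 0 (fsub x N v) (fsub x (shift 0 N) t)
  fsub-sub0 x N v t = begin
    fsub x N (sub 0 v t)                                        ≡⟨ fsub-sbst x N (sub 0 v t) ⟩
    sbst bvar φ (sub 0 v t)                                     ≡⟨ cong (sbst bvar φ) (sub0-eq v t) ⟩
    sbst bvar φ (sub0 v t)                                      ≡⟨ sub0-sbst bvar φ v t ⟩
    sub0 (sbst bvar φ v) (sbst (exts bvar) (ren suc ∘ φ) t)
      ≡⟨ cong₂ sub0 (sym (fsub-sbst x N v)) (sym (lifted t)) ⟩
    sub0 (fsub x N v) (fsub x (shift 0 N) t)
      ≡⟨ sym (sub0-eq (fsub x N v) (fsub x (shift 0 N) t)) ⟩
    sub 0 (fsub x N v) (fsub x (shift 0 N) t)                   ∎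
    where
    open ≡-Reasoning
    φ = fsubφ x N
    lifted : ∀ t → fsub x (shift 0 N) t ≡ sbst (exts bvar) (ren suc ∘ φ) t
    lifted t = trans (fsub-sbst x (shift 0 N) t)
                     (sbst-cong (λ { zero → refl ; (suc n) → refl }) (fsubφ-shift x N) t)

open Substitution

-- Standardisation: βδ-reduction to a boolean is captured by head evaluation.
module Standardisation where

  infix 4 _⇉_ _⇉ᵢ_ _→h_ _→h*_
  data _⇉_ : Term → Term → Set where
    pbvar : ∀ {n} → bvar n ⇉ bvar n
    pfvar : ∀ {x} → fvar x ⇉ fvar x
    pff   : ff ⇉ ff
    ptt   : tt ⇉ tt
    plam  : ∀ {t t'} → t ⇉ t' → lam t ⇉ lam t'
    papp  : ∀ {t t' u u'} → t ⇉ t' → u ⇉ u' → app t u ⇉ app t' u'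
    pite  : ∀ {c c' a a' b b'} → c ⇉ c' → a ⇉ a' → b ⇉ b' → ite c a b ⇉ ite c' a' b'
    pβ    : ∀ {t t' u u'} → t ⇉ t' → u ⇉ u' → app (lam t) u ⇉ sub0 u' t'
    pδT   : ∀ {a a' b} → a ⇉ a' → ite tt a b ⇉ a'
    pδF   : ∀ {a b b'} → b ⇉ b' → ite ff a b ⇉ b'

  par-refl : ∀ t → t ⇉ t
  par-refl (bvar n) = pbvar
  par-refl (fvar x) = pfvar
  par-refl ff = pff
  par-refl tt = ptt
  par-refl (lam t) = plam (par-refl t)
  par-refl (app t u) = papp (par-refl t) (par-refl u)
  par-refl (ite t u v) = pite (par-refl t) (par-refl u) (par-refl v)

  step⇒par : ∀ {t t'} → t ⟶ t' → t ⇉ t'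
  step⇒par (β {t} {u}) rewrite sub0-eq u t = pβ (par-refl t) (par-refl u)
  step⇒par (δT {u}) = pδT (par-refl u)
  step⇒par (δF {v = v}) = pδF (par-refl v)
  step⇒par (ξlam s) = plam (step⇒par s)
  step⇒par (ξappl {u = u} s) = papp (step⇒par s) (par-refl u)
  step⇒par (ξappr {t = t} s) = papp (par-refl t) (step⇒par s)
  step⇒par (ξite₀ {u = u} {v = v} s) = pite (step⇒par s) (par-refl u) (par-refl v)
  step⇒par (ξite₁ {t = t} {v = v} s) = pite (par-refl t) (step⇒par s) (par-refl v)
  step⇒par (ξite₂ {t = t} {u = u} s) = pite (par-refl t) (par-refl u) (step⇒par s)

  par-ren : ∀ ρ {t t'} → t ⇉ t' → ren ρ t ⇉ ren ρ t'
  par-ren ρ pbvar = pbvar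
  par-ren ρ pfvar = pfvar
  par-ren ρ pff = pff
  par-ren ρ ptt = ptt
  par-ren ρ (plam p) = plam (par-ren (ext ρ) p)
  par-ren ρ (papp p q) = papp (par-ren ρ p) (par-ren ρ q)
  par-ren ρ (pite p q r) = pite (par-ren ρ p) (par-ren ρ q) (par-ren ρ r)
  par-ren ρ (pβ {t' = t'} {u' = u'} p q) rewrite ren-sub0 ρ u' t' = pβ (par-ren (ext ρ) p) (par-ren ρ q)
  par-ren ρ (pδT p) = pδT (par-ren ρ p)
  par-ren ρ (pδF p) = pδF (par-ren ρ p)

  _⇉ₛ_ : (ℕ → Term) → (ℕ → Term) → Set
  σ ⇉ₛ σ' = ∀ n → σ n ⇉ σ' n

  par-exts : ∀ {σ σ'} → σ ⇉ₛ σ' → exts σ ⇉ₛ exts σ'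
  par-exts e zero = pbvar
  par-exts e (suc n) = par-ren suc (e n)

  par-sbst : ∀ {σ σ' φ φ' t t'} → t ⇉ t' → σ ⇉ₛ σ' → φ ⇉ₛ φ' → sbst σ φ t ⇉ sbst σ' φ' t'
  par-sbst pbvar e f = e _
  par-sbst pfvar e f = f _
  par-sbst pff e f = pff
  par-sbst ptt e f = ptt
  par-sbst (plam p) e f = plam (par-sbst p (par-exts e) (par-ren suc ∘ f))
  par-sbst (papp p q) e f = papp (par-sbst p e f) (par-sbst q e f)
  par-sbst (pite p q r) e f = pite (par-sbst p e f) (par-sbst q e f) (par-sbst r e f)
  par-sbst {σ' = σ'} {φ' = φ'} (pβ {t' = t'} {u' = u'} p q) e f rewrite sub0-sbst σ' φ' u' t' =
    pβ (par-sbst p (par-exts e) (par-ren suc ∘ f)) (par-sbst q e f)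
  par-sbst (pδT p) e f = pδT (par-sbst p e f)
  par-sbst (pδF p) e f = pδF (par-sbst p e f)

  par-σ0 : ∀ {u u'} → u ⇉ u' → σ0 u ⇉ₛ σ0 u'
  par-σ0 q zero = q
  par-σ0 q (suc n) = pbvar

  par-sub0 : ∀ {t t' u u'} → t ⇉ t' → u ⇉ u' → sub0 u t ⇉ sub0 u' t'
  par-sub0 p q = par-sbst p (par-σ0 q) (λ _ → pfvar)

  data _→h_ : Term → Term → Set where
    hβ   : ∀ {t u} → app (lam t) u →h sub0 u t
    hT   : ∀ {a b} → ite tt a b →h a
    hF   : ∀ {a b} → ite ff a b →h b
    happ : ∀ {t t' u} → t →h t' → app t u →h app t' u
    hite : ∀ {c c' a b} → c →h c' → ite c a b →h ite c' a b

  _→h*_ : Term → Term → Set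
  _→h*_ = Star _→h_

  h-sbst : ∀ σ φ {t t'} → t →h t' → sbst σ φ t →h sbst σ φ t'
  h-sbst σ φ (hβ {t} {u}) rewrite sub0-sbst σ φ u t = hβ
  h-sbst σ φ hT = hT
  h-sbst σ φ hF = hF
  h-sbst σ φ (happ r) = happ (h-sbst σ φ r)
  h-sbst σ φ (hite r) = hite (h-sbst σ φ r)

  data _⇉ᵢ_ : Term → Term → Set where
    ibvar : ∀ {n} → bvar n ⇉ᵢ bvar n
    ifvar : ∀ {x} → fvar x ⇉ᵢ fvar x
    iff   : ff ⇉ᵢ ff
    itt   : tt ⇉ᵢ tt
    ilam  : ∀ {t t'} → t ⇉ t' → lam t ⇉ᵢ lam t'
    iapp  : ∀ {t t' u u'} → t ⇉ᵢ t' → u ⇉ u' → app t u ⇉ᵢ app t' u'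
    iite  : ∀ {c c' a a' b b'} → c ⇉ᵢ c' → a ⇉ a' → b ⇉ b' → ite c a b ⇉ᵢ ite c' a' b'

  HeadFactor : Term → Term → Set
  HeadFactor t t' = Σ Term λ s → (t →h* s) × (s ⇉ᵢ t')

  factor-app : ∀ {t t' u u'} → u ⇉ u' → HeadFactor t t' → HeadFactor (app t u) (app t' u')
  factor-app {u = u} q (s , red , i) = app s u , gmap (λ z → app z u) happ red , iapp i q

  factor-ite : ∀ {c c' a a' b b'} → a ⇉ a' → b ⇉ b' → HeadFactor c c' → HeadFactor (ite c a b) (ite c' a' b')
  factor-ite {a = a} {b = b} p q (s , red , i) = ite s a b , gmap (λ z → ite z a b) hite red , iite i p q

  factor-head : ∀ {t s t'} → t →h* s → HeadFactor s t' → HeadFactor t t'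
  factor-head red (s , red' , i) = s , red ◅◅ red' , i

  factor-sub0 : ∀ {P P' Q Q'} → P ⇉ᵢ P' → Q ⇉ Q' → HeadFactor Q Q' → HeadFactor (sub0 Q P) (sub0 Q' P')
  factor-sub0 (ibvar {zero}) q hq = hq
  factor-sub0 (ibvar {suc n}) q hq = bvar n , ε , ibvar
  factor-sub0 ifvar q hq = _ , ε , ifvar
  factor-sub0 iff q hq = ff , ε , iff
  factor-sub0 itt q hq = tt , ε , itt
  factor-sub0 (ilam p) q hq = _ , ε , ilam (par-sbst p (par-exts (par-σ0 q)) (λ _ → pfvar))
  factor-sub0 (iapp p r) q hq = factor-app (par-sub0 r q) (factor-sub0 p q hq)
  factor-sub0 (iite p r r') q hq = factor-ite (par-sub0 r q) (par-sub0 r' q) (factor-sub0 p q hq)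

  factor : ∀ {t t'} → t ⇉ t' → HeadFactor t t'
  factor pbvar = _ , ε , ibvar
  factor pfvar = _ , ε , ifvar
  factor pff = ff , ε , iff
  factor ptt = tt , ε , itt
  factor (plam p) = _ , ε , ilam p
  factor (papp p q) = factor-app q (factor p)
  factor (pite p q r) = factor-ite q r (factor p)
  factor (pβ {u = Q} p q) with factor p
  ... | _ , red , i = factor-head (hβ ◅ gmap (sub0 Q) (h-sbst (σ0 Q) fvar) red) (factor-sub0 i q (factor q))
  factor (pδT p) = factor-head (hT ◅ ε) (factor p)
  factor (pδF p) = factor-head (hF ◅ ε) (factor p)

  -- Eval n b t Ns: the head evaluation of t applied to the stack Ns
  -- reaches the boolean b; n bounds the number of machine branchings
  -- (β-steps and ifs), so it serves as a termination measure.
  data Eval : ℕ → Ans → Term → List Term → Set where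
    eT   : Eval 0 yes tt []
    eF   : Eval 0 no ff []
    eβ   : ∀ {n b t u Ns} → Eval n b (sub0 u t) Ns → Eval (suc n) b (lam t) (u ∷ Ns)
    eapp : ∀ {n b t u Ns} → Eval n b t (u ∷ Ns) → Eval n b (app t u) Ns
    eif₁ : ∀ {n m b c t e Ns} → Eval n yes c [] → Eval m b t Ns → Eval (suc (n ⊔ m)) b (ite c t e) Ns
    eif₂ : ∀ {n m b c t e Ns} → Eval n no c [] → Eval m b e Ns → Eval (suc (n ⊔ m)) b (ite c t e) Ns

  Evaluates : Ans → Term → List Term → Set
  Evaluates b t Ns = Σ ℕ λ n → Eval n b t Ns

  eval-≡ : ∀ {n b t t' Ns} → t ≡ t' → Eval n b t Ns → Eval n b t' Ns
  eval-≡ refl d = d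

  eval-head : ∀ {n b t s Ns} → t →h s → Eval n b s Ns → Evaluates b t Ns
  eval-head hβ d = _ , eapp (eβ d)
  eval-head hT d = _ , eif₁ eT d
  eval-head hF d = _ , eif₂ eF d
  eval-head (happ r) (eapp d) with eval-head r d
  ... | _ , d' = _ , eapp d'
  eval-head (hite r) (eif₁ dc d) with eval-head r dc
  ... | _ , dc' = _ , eif₁ dc' d
  eval-head (hite r) (eif₂ dc d) with eval-head r dc
  ... | _ , dc' = _ , eif₂ dc' d

  eval-head* : ∀ {b t s Ns} → t →h* s → Evaluates b s Ns → Evaluates b t Ns
  eval-head* ε d = d
  eval-head* (r ◅ rs) d with eval-head* rs d
  ... | _ , d' = eval-head r d'

  data _⇉ₗ_ : List Term → List Term → Set where
    []  : [] ⇉ₗ []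
    _∷_ : ∀ {u u' Ns Ns'} → u ⇉ u' → Ns ⇉ₗ Ns' → (u ∷ Ns) ⇉ₗ (u' ∷ Ns')

  mutual
    eval-par : ∀ {n b t t' Ns Ns'} → Eval n b t' Ns' → t ⇉ t' → Ns ⇉ₗ Ns' → Evaluates b t Ns
    eval-par d p ps with factor p
    ... | s , red , i = eval-head* red (eval-internal d i ps)

    eval-internal : ∀ {n b s t' Ns Ns'} → Eval n b t' Ns' → s ⇉ᵢ t' → Ns ⇉ₗ Ns' → Evaluates b s Ns
    eval-internal eT itt [] = _ , eT
    eval-internal eF iff [] = _ , eF
    eval-internal (eβ d) (ilam p) (q ∷ ps) with eval-par d (par-sub0 p q) ps
    ... | _ , d' = _ , eβ d'
    eval-internal (eapp d) (iapp i q) ps with eval-internal d i (q ∷ ps)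
    ... | _ , d' = _ , eapp d'
    eval-internal (eif₁ dc d) (iite ic pa pb) ps with eval-internal dc ic [] | eval-par d pa ps
    ... | _ , dc' | _ , d' = _ , eif₁ dc' d'
    eval-internal (eif₂ dc d) (iite ic pa pb) ps with eval-internal dc ic [] | eval-par d pb ps
    ... | _ , dc' | _ , d' = _ , eif₂ dc' d'

  val : Ans → Term
  val yes = tt
  val no = ff

  eval-complete : ∀ {b t} → t ⟶* val b → Evaluates b t []
  eval-complete {yes} ε = _ , eT
  eval-complete {no} ε = _ , eF
  eval-complete (s ◅ rs) with eval-complete rs
  ... | _ , d = eval-par d (step⇒par s) []

  apps-step : ∀ {t t'} Ns → t ⟶ t' → apps t Ns ⟶ apps t' Ns
  apps-step [] s = s
  apps-step (u ∷ Ns) s = apps-step Ns (ξappl s)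

  apps-steps : ∀ {t t'} Ns → t ⟶* t' → apps t Ns ⟶* apps t' Ns
  apps-steps Ns = gmap (λ z → apps z Ns) (apps-step Ns)

  cond-steps : ∀ {c c' a b} → c ⟶* c' → ite c a b ⟶* ite c' a b
  cond-steps = gmap (λ z → ite z _ _) ξite₀

  eval-sound : ∀ {n b t Ns} → Eval n b t Ns → apps t Ns ⟶* val b
  eval-sound eT = ε
  eval-sound eF = ε
  eval-sound (eβ {t = t} {u = u} {Ns = Ns} d) rewrite sym (sub0-eq u t) = apps-step Ns β ◅ eval-sound d
  eval-sound (eapp d) = eval-sound d
  eval-sound (eif₁ {Ns = Ns} dc d) =
    apps-steps Ns (cond-steps (eval-sound dc)) ◅◅ (apps-step Ns δT ◅ eval-sound d)
  eval-sound (eif₂ {Ns = Ns} dc d) =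
    apps-steps Ns (cond-steps (eval-sound dc)) ◅◅ (apps-step Ns δF ◅ eval-sound d)

open Standardisation

-- The denotation of machine states, and how the transitions act on it.
module Unfolding where

  ≡ᵇ-refl : ∀ x → (x ≡ᵇ x) ≡ true
  ≡ᵇ-refl x = Equivalence.to T-≡ (≡⇒≡ᵇ x x refl)

  ≡ᵇ-≢ : ∀ x y → x ≢ y → (x ≡ᵇ y) ≡ false
  ≡ᵇ-≢ x y x≢y = ¬-not (x≢y ∘ ≡ᵇ⇒≡ x y ∘ Equivalence.from T-≡)

  fv-appˡ : ∀ {x} t u → x ∈ fv t → x ∈ fv (app t u)
  fv-appˡ t u = ∈-++⁺ˡ

  fv-appʳ : ∀ {x} t u → x ∈ fv u → x ∈ fv (app t u)
  fv-appʳ t u = ∈-++⁺ʳ (fv t)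

  fv-ite₀ : ∀ {x} t u v → x ∈ fv t → x ∈ fv (ite t u v)
  fv-ite₀ t u v = ∈-++⁺ˡ

  fv-ite₁ : ∀ {x} t u v → x ∈ fv u → x ∈ fv (ite t u v)
  fv-ite₁ t u v = ∈-++⁺ʳ (fv t) ∘ ∈-++⁺ˡ

  fv-ite₂ : ∀ {x} t u v → x ∈ fv v → x ∈ fv (ite t u v)
  fv-ite₂ t u v = ∈-++⁺ʳ (fv t) ∘ ∈-++⁺ʳ (fv u)

  fsub-∉ : ∀ x u t → x ∉ fv t → fsub x u t ≡ t
  fsub-∉ x u (bvar n) x∉ = refl
  fsub-∉ x u (fvar y) x∉ rewrite ≡ᵇ-≢ x y (x∉ ∘ here) = refl
  fsub-∉ x u ff x∉ = refl
  fsub-∉ x u tt x∉ = refl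
  fsub-∉ x u (lam t) x∉ = cong lam (fsub-∉ x (shift 0 u) t x∉)
  fsub-∉ x u (app t t') x∉ = cong₂ app (fsub-∉ x u t (x∉ ∘ fv-appˡ t t')) (fsub-∉ x u t' (x∉ ∘ fv-appʳ t t'))
  fsub-∉ x u (ite t t' t'') x∉ =
    cong₃ ite (fsub-∉ x u t (x∉ ∘ fv-ite₀ t t' t'')) (fsub-∉ x u t' (x∉ ∘ fv-ite₁ t t' t''))
              (fsub-∉ x u t'' (x∉ ∘ fv-ite₂ t t' t''))

  fsub-open : ∀ x u j t → x ∉ fv t → fsub x u (sub j (fvar x) t) ≡ sub j u t
  fsub-open x u j (bvar n) x∉ with n ≡ᵇ j
  ... | true rewrite ≡ᵇ-refl x = refl
  ... | false with j <ᵇ n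
  ... | true = refl
  ... | false = refl
  fsub-open x u j (fvar y) x∉ rewrite ≡ᵇ-≢ x y (x∉ ∘ here) = refl
  fsub-open x u j ff x∉ = refl
  fsub-open x u j tt x∉ = refl
  fsub-open x u j (lam t) x∉ = cong lam (fsub-open x (shift 0 u) (suc j) t x∉)
  fsub-open x u j (app t t') x∉ =
    cong₂ app (fsub-open x u j t (x∉ ∘ fv-appˡ t t')) (fsub-open x u j t' (x∉ ∘ fv-appʳ t t'))
  fsub-open x u j (ite t t' t'') x∉ =
    cong₃ ite (fsub-open x u j t (x∉ ∘ fv-ite₀ t t' t'')) (fsub-open x u j t' (x∉ ∘ fv-ite₁ t t' t''))
              (fsub-open x u j t'' (x∉ ∘ fv-ite₂ t t' t''))

  ∉-apps-head : ∀ {x} h Ns → x ∉ fv (apps h Ns) → x ∉ fv h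
  ∉-apps-head h [] x∉ = x∉
  ∉-apps-head h (u ∷ Ns) x∉ = ∉-apps-head (app h u) Ns x∉ ∘ fv-appˡ h u

  ∉-apps-args : ∀ {x} h Ns → x ∉ fv (apps h Ns) → All (λ u → x ∉ fv u) Ns
  ∉-apps-args h [] x∉ = []
  ∉-apps-args h (u ∷ Ns) x∉ = (∉-apps-head (app h u) Ns x∉ ∘ fv-appʳ h u) ∷ ∉-apps-args (app h u) Ns x∉

  -- The meaning of a machine state: the assignments of 𝒜 substituted into
  -- the term, the most recent one innermost.  `unfL` does so under one binder.
  unf : MCtx → Term → Term
  unf [] t = t
  unf ((x , N) ∷ 𝒜) t = fsub x N (unf 𝒜 t)

  unfL : MCtx → Term → Term
  unfL [] t = t
  unfL ((x , N) ∷ 𝒜) t = fsub x (shift 0 N) (unfL 𝒜 t)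

  unf-app : ∀ 𝒜 a b → unf 𝒜 (app a b) ≡ app (unf 𝒜 a) (unf 𝒜 b)
  unf-app [] a b = refl
  unf-app ((x , N) ∷ 𝒜) a b = cong (fsub x N) (unf-app 𝒜 a b)

  unf-ite : ∀ 𝒜 a b c → unf 𝒜 (ite a b c) ≡ ite (unf 𝒜 a) (unf 𝒜 b) (unf 𝒜 c)
  unf-ite [] a b c = refl
  unf-ite ((x , N) ∷ 𝒜) a b c = cong (fsub x N) (unf-ite 𝒜 a b c)

  unf-lam : ∀ 𝒜 t → unf 𝒜 (lam t) ≡ lam (unfL 𝒜 t)
  unf-lam [] t = refl
  unf-lam ((x , N) ∷ 𝒜) t = cong (fsub x N) (unf-lam 𝒜 t)

  unf-val : ∀ 𝒜 b → unf 𝒜 (val b) ≡ val b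
  unf-val [] b = refl
  unf-val ((x , N) ∷ 𝒜) yes = cong (fsub x N) (unf-val 𝒜 yes)
  unf-val ((x , N) ∷ 𝒜) no = cong (fsub x N) (unf-val 𝒜 no)

  unf-bvar : ∀ 𝒜 n → unf 𝒜 (bvar n) ≡ bvar n
  unf-bvar [] n = refl
  unf-bvar ((x , N) ∷ 𝒜) n = cong (fsub x N) (unf-bvar 𝒜 n)

  unf-sub : ∀ 𝒜 u t → unf 𝒜 (sub 0 u t) ≡ sub 0 (unf 𝒜 u) (unfL 𝒜 t)
  unf-sub [] u t = refl
  unf-sub ((x , N) ∷ 𝒜) u t = trans (cong (fsub x N) (unf-sub 𝒜 u t)) (fsub-sub0 x N (unf 𝒜 u) (unfL 𝒜 t))

  unf-apps : ∀ 𝒜 h Ns → unf 𝒜 (apps h Ns) ≡ apps (unf 𝒜 h) (map (unf 𝒜) Ns)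
  unf-apps 𝒜 h [] = refl
  unf-apps 𝒜 h (u ∷ Ns) =
    trans (unf-apps 𝒜 (app h u) Ns) (cong (λ z → apps z (map (unf 𝒜) Ns)) (unf-app 𝒜 h u))

  unf-++ : ∀ 𝒜₁ 𝒜₂ t → unf (𝒜₁ ++ 𝒜₂) t ≡ unf 𝒜₁ (unf 𝒜₂ t)
  unf-++ [] 𝒜₂ t = refl
  unf-++ ((x , N) ∷ 𝒜₁) 𝒜₂ t = cong (fsub x N) (unf-++ 𝒜₁ 𝒜₂ t)

  assigned : MCtx → List ℕ
  assigned = map proj₁

  unf-closed : ∀ 𝒜 t → (∀ y → y ∈ fv t → y ∉ assigned 𝒜) → unf 𝒜 t ≡ t
  unf-closed [] t closed = refl
  unf-closed ((x , N) ∷ 𝒜) t closed =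
    trans (cong (fsub x N) (unf-closed 𝒜 t (λ y y∈ → closed y y∈ ∘ there)))
          (fsub-∉ x N t (λ x∈ → closed x x∈ (here refl)))

  WellFormed : MCtx → Set
  WellFormed [] = ⊤
  WellFormed ((x , N) ∷ 𝒜) = (x ∉ assigned 𝒜) × (∀ y → y ∈ fv N → y ∉ x ∷ assigned 𝒜) × WellFormed 𝒜

  wf-suffix : ∀ 𝒜₁ {𝒜₂} → WellFormed (𝒜₁ ++ 𝒜₂) → WellFormed 𝒜₂
  wf-suffix [] wf = wf
  wf-suffix (_ ∷ 𝒜₁) (_ , _ , wf) = wf-suffix 𝒜₁ wf

  unf-lookup : ∀ 𝒜₁ 𝒜₂ x N → WellFormed (𝒜₁ ++ (x , N) ∷ 𝒜₂) →
    unf (𝒜₁ ++ (x , N) ∷ 𝒜₂) (fvar x) ≡ unf (𝒜₁ ++ (x , N) ∷ 𝒜₂) N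
  unf-lookup 𝒜₁ 𝒜₂ x N wf with wf-suffix 𝒜₁ wf
  ... | x∉ , fvN , _ = begin
    unf (𝒜₁ ++ (x , N) ∷ 𝒜₂) (fvar x)     ≡⟨ unf-++ 𝒜₁ _ (fvar x) ⟩
    unf 𝒜₁ (fsub x N (unf 𝒜₂ (fvar x)))
      ≡⟨ cong (λ z → unf 𝒜₁ (fsub x N z)) (unf-closed 𝒜₂ (fvar x) (λ { y (here refl) → x∉ })) ⟩
    unf 𝒜₁ (fsub x N (fvar x))             ≡⟨ cong (λ b → unf 𝒜₁ (if b then N else fvar x)) (≡ᵇ-refl x) ⟩
    unf 𝒜₁ N                               ≡⟨ cong (unf 𝒜₁) (sym (fsub-∉ x N N (λ x∈ → fvN x x∈ (here refl)))) ⟩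
    unf 𝒜₁ (fsub x N N)
      ≡⟨ cong (λ z → unf 𝒜₁ (fsub x N z)) (sym (unf-closed 𝒜₂ N (λ y y∈ → fvN y y∈ ∘ there))) ⟩
    unf 𝒜₁ (fsub x N (unf 𝒜₂ N))           ≡⟨ sym (unf-++ 𝒜₁ _ N) ⟩
    unf (𝒜₁ ++ (x , N) ∷ 𝒜₂) N            ∎
    where open ≡-Reasoning

  assigned-snoc⁻ : ∀ 𝒜 {y x N} → y ∈ assigned (𝒜 ++ (x , N) ∷ []) → y ∈ assigned 𝒜 ⊎ y ≡ x
  assigned-snoc⁻ 𝒜 {y} y∈ with ∈-++⁻ (assigned 𝒜) (subst (y ∈_) (map-++ proj₁ 𝒜 _) y∈)
  ... | inj₁ y∈𝒜 = inj₁ y∈𝒜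
  ... | inj₂ (here y≡x) = inj₂ y≡x

  wf-snoc : ∀ 𝒜 {x' N'} → WellFormed 𝒜 → x' ∉ assigned 𝒜 → All (λ p → x' ∉ fv (proj₂ p)) 𝒜 → x' ∉ fv N' →
    WellFormed (𝒜 ++ (x' , N') ∷ [])
  wf-snoc [] wf x'∉ [] x'∉N' = (λ ()) , (λ { y y∈ (here refl) → x'∉N' y∈ }) , _
  wf-snoc ((x , N) ∷ 𝒜) (x∉ , fvN , wf) x'∉ (x'∉N ∷ x'∉𝒜) x'∉N' =
    [ x∉ , (λ { refl → x'∉ (here refl) }) ] ∘ assigned-snoc⁻ 𝒜 ,
    (λ { y y∈ (here refl) → fvN y y∈ (here refl)
       ; y y∈ (there y∈𝒜) →
           [ fvN y y∈ ∘ there , (λ { refl → x'∉N y∈ }) ] (assigned-snoc⁻ 𝒜 y∈𝒜) }) ,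
    wf-snoc 𝒜 wf (x'∉ ∘ there) x'∉𝒜 x'∉N'

  eval-apps⁻ : ∀ {n b t} Ns {Ms} → Eval n b (apps t Ns) Ms → Eval n b t (Ns ++ Ms)
  eval-apps⁻ [] d = d
  eval-apps⁻ (u ∷ Ns) d with eval-apps⁻ Ns d
  ... | eapp d' = d'

  eval-apps⁺ : ∀ {n b t} Ns {Ms} → Eval n b t (Ns ++ Ms) → Eval n b (apps t Ns) Ms
  eval-apps⁺ [] d = d
  eval-apps⁺ (u ∷ Ns) d = eval-apps⁺ Ns (eapp d)

  unstack : ∀ {n b} 𝒜 h Ns → Eval n b (unf 𝒜 (apps h Ns)) [] → Eval n b (unf 𝒜 h) (map (unf 𝒜) Ns)
  unstack 𝒜 h Ns d rewrite unf-apps 𝒜 h Ns =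
    subst (Eval _ _ _) (++-identityʳ _) (eval-apps⁻ (map (unf 𝒜) Ns) d)

  restack : ∀ {n b} 𝒜 h Ns → Eval n b (unf 𝒜 h) (map (unf 𝒜) Ns) → Eval n b (unf 𝒜 (apps h Ns)) []
  restack 𝒜 h Ns d rewrite unf-apps 𝒜 h Ns =
    eval-apps⁺ (map (unf 𝒜) Ns) (subst (Eval _ _ _) (sym (++-identityʳ _)) d)

  unf-lookup-apps : ∀ 𝒜₁ 𝒜₂ x N Ns → WellFormed (𝒜₁ ++ (x , N) ∷ 𝒜₂) →
    unf (𝒜₁ ++ (x , N) ∷ 𝒜₂) (apps (fvar x) Ns) ≡ unf (𝒜₁ ++ (x , N) ∷ 𝒜₂) (apps N Ns)
  unf-lookup-apps 𝒜₁ 𝒜₂ x N Ns wf = begin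
    unf 𝒜 (apps (fvar x) Ns)                 ≡⟨ unf-apps 𝒜 (fvar x) Ns ⟩
    apps (unf 𝒜 (fvar x)) (map (unf 𝒜) Ns)
      ≡⟨ cong (λ z → apps z (map (unf 𝒜) Ns)) (unf-lookup 𝒜₁ 𝒜₂ x N wf) ⟩
    apps (unf 𝒜 N) (map (unf 𝒜) Ns)          ≡⟨ sym (unf-apps 𝒜 N Ns) ⟩
    unf 𝒜 (apps N Ns)                        ∎
    where
    open ≡-Reasoning
    𝒜 = 𝒜₁ ++ (x , N) ∷ 𝒜₂

  unf-β : ∀ 𝒜 {x' N N₁} Ns → Fresh x' 𝒜 (apps (lam N) (N₁ ∷ Ns)) →
    (unf (𝒜 ++ (x' , N₁) ∷ []) (sub 0 (fvar x') N) ≡ sub0 (unf 𝒜 N₁) (unfL 𝒜 N)) ×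
    (map (unf (𝒜 ++ (x' , N₁) ∷ [])) Ns ≡ map (unf 𝒜) Ns)
  unf-β 𝒜 {x'} {N} {N₁} Ns (_ , x'∉ , _) with ∉-apps-args (lam N) (N₁ ∷ Ns) x'∉
  ... | x'∉N₁ ∷ x'∉Ns = contractum , map-cong-local (All.map unf-snoc x'∉Ns)
    where
    open ≡-Reasoning
    𝒜' = 𝒜 ++ (x' , N₁) ∷ []
    unf-snoc : ∀ {v} → x' ∉ fv v → unf 𝒜' v ≡ unf 𝒜 v
    unf-snoc {v} x'∉v = trans (unf-++ 𝒜 _ v) (cong (unf 𝒜) (fsub-∉ x' N₁ v x'∉v))
    contractum : unf 𝒜' (sub 0 (fvar x') N) ≡ sub0 (unf 𝒜 N₁) (unfL 𝒜 N)
    contractum = begin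
      unf 𝒜' (sub 0 (fvar x') N)             ≡⟨ unf-++ 𝒜 _ _ ⟩
      unf 𝒜 (fsub x' N₁ (sub 0 (fvar x') N))
        ≡⟨ cong (unf 𝒜) (fsub-open x' N₁ 0 N (∉-apps-head (lam N) (N₁ ∷ Ns) x'∉)) ⟩
      unf 𝒜 (sub 0 N₁ N)                     ≡⟨ unf-sub 𝒜 N₁ N ⟩
      sub 0 (unf 𝒜 N₁) (unfL 𝒜 N)            ≡⟨ sub0-eq (unf 𝒜 N₁) (unfL 𝒜 N) ⟩
      sub0 (unf 𝒜 N₁) (unfL 𝒜 N)             ∎

  wf-β : ∀ 𝒜 {x' N N₁} Ns → WellFormed 𝒜 → Fresh x' 𝒜 (apps (lam N) (N₁ ∷ Ns)) →
    WellFormed (𝒜 ++ (x' , N₁) ∷ [])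
  wf-β 𝒜 {N = N} {N₁} Ns wf (x'∉𝒜 , x'∉ , x'∉vals) with ∉-apps-args (lam N) (N₁ ∷ Ns) x'∉
  ... | x'∉N₁ ∷ _ = wf-snoc 𝒜 wf x'∉𝒜 x'∉vals x'∉N₁

open Unfolding

-- Soundness: accepted configurations denote terms evaluating to their answers.
module Soundness where

  -- What acceptance of a configuration guarantees (in a well-formed context):
  -- every existential component evaluates, after unfolding, to its expected answer.
  Meaning : Conf → Set
  Meaning Rejecting = ⊥
  Meaning Accepting = ⊤
  Meaning ∃⟦ 𝒜 ∣ b ⸴ t ⟧ = WellFormed 𝒜 → Evaluates b (unf 𝒜 t) []
  Meaning ∀⟦ 𝒜 ∣ a ⸴ M ∣ b ⸴ N ⟧ =
    WellFormed 𝒜 → Evaluates a (unf 𝒜 M) [] × Evaluates b (unf 𝒜 N) []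

  sound-step : ∀ {𝒜 b t c} → ∃⟦ 𝒜 ∣ b ⸴ t ⟧ ↦ c → Meaning c → Meaning ∃⟦ 𝒜 ∣ b ⸴ t ⟧
  sound-step (tβ {𝒜} {b} {N} {N₁} {Ns} {x'} fresh) ih wf with ih (wf-β 𝒜 Ns wf fresh) | unf-β 𝒜 Ns fresh
  ... | n , d | contractum , args =
    suc n ,
    restack 𝒜 (lam N) (N₁ ∷ Ns) (eval-≡ (sym (unf-lam 𝒜 N)) (eβ (subst₂ (Eval n b) contractum args d')))
    where
    d' = unstack (𝒜 ++ (x' , N₁) ∷ []) (sub 0 (fvar x') N) Ns d
  sound-step (th {𝒜₁} {𝒜₂} {x} {N} {Ns = Ns}) ih wf with ih wf
  ... | n , d = n , eval-≡ (sym (unf-lookup-apps 𝒜₁ 𝒜₂ x N Ns wf)) d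
  sound-step (tif₁ {𝒜} {M₀ = M₀} {M₁} {M₂} {Ns}) ih wf with ih wf
  ... | (_ , d₀) , (_ , d₁) =
    _ , restack 𝒜 (ite M₀ M₁ M₂) Ns
          (eval-≡ (sym (unf-ite 𝒜 M₀ M₁ M₂)) (eif₁ d₀ (unstack 𝒜 M₁ Ns d₁)))
  sound-step (tif₂ {𝒜} {M₀ = M₀} {M₁} {M₂} {Ns}) ih wf with ih wf
  ... | (_ , d₀) , (_ , d₂) =
    _ , restack 𝒜 (ite M₀ M₁ M₂) Ns
          (eval-≡ (sym (unf-ite 𝒜 M₀ M₁ M₂)) (eif₂ d₀ (unstack 𝒜 M₂ Ns d₂)))
  sound-step (tyT {𝒜}) ih wf = 0 , eval-≡ (sym (unf-val 𝒜 yes)) eT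
  sound-step (tnF {𝒜}) ih wf = 0 , eval-≡ (sym (unf-val 𝒜 no)) eF
  sound-step tnT ()
  sound-step tyF ()

  sound : ∀ {c} → Accepted c → Meaning c
  sound acc = _
  sound (exi s a) = sound-step s (sound a)
  sound (uni next) wf = sound (next _ tif'₁) wf , sound (next _ tif'₂) wf

open Soundness

-- Completeness: states whose denotation evaluates to b are accepted.
module Completeness where

  names : MCtx → Term → List ℕ
  names [] t = fv t
  names ((x , N) ∷ 𝒜) t = x ∷ fv N ++ names 𝒜 t

  fresh : MCtx → Term → ℕ
  fresh 𝒜 t = suc (max 0 (names 𝒜 t))

  fresh-∉ : ∀ xs → suc (max 0 xs) ∉ xs
  fresh-∉ xs x∈ = n≮n _ (All.lookup (xs≤max 0 xs) x∈)

  fresh-Fresh : ∀ 𝒜 t → Fresh (fresh 𝒜 t) 𝒜 t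
  fresh-Fresh 𝒜 t = absent 𝒜 (fresh-∉ (names 𝒜 t))
    where
    absent : ∀ 𝒜 {x} → x ∉ names 𝒜 t → Fresh x 𝒜 t
    absent [] x∉ = (λ ()) , x∉ , []
    absent ((y , N) ∷ 𝒜) x∉ with absent 𝒜 (x∉ ∘ there ∘ ∈-++⁺ʳ (fv N))
    ... | x∉𝒜 , x∉t , x∉vals =
      (λ { (here refl) → x∉ (here refl) ; (there x∈) → x∉𝒜 x∈ }) , x∉t , (x∉ ∘ there ∘ ∈-++⁺ˡ) ∷ x∉vals

  -- Heads at which the machine performs no lookup step.
  data Head (𝒜 : MCtx) : Term → Set where
    lam-head  : ∀ N → Head 𝒜 (lam N)
    ite-head  : ∀ M₀ M₁ M₂ → Head 𝒜 (ite M₀ M₁ M₂)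
    val-head  : ∀ a → Head 𝒜 (val a)
    bvar-head : ∀ n → Head 𝒜 (bvar n)
    free-head : ∀ {x} → x ∉ assigned 𝒜 → Head 𝒜 (fvar x)

  -- The outcome of following the lookups from the term t: a spine with a
  -- `Head`, unfolding like t, from which acceptance transfers back to t.
  record Resolved (𝒜 : MCtx) (t : Term) : Set where
    constructor resolved
    field
      head    : Term
      args    : List Term
      is-head : Head 𝒜 head
      same    : unf 𝒜 (apps head args) ≡ unf 𝒜 t
      back    : ∀ b → Accepted ∃⟦ 𝒜 ∣ b ⸴ apps head args ⟧ → Accepted ∃⟦ 𝒜 ∣ b ⸴ t ⟧

  already : ∀ {𝒜 h} Ns → Head 𝒜 h → Resolved 𝒜 (apps h Ns)
  already Ns hd = resolved _ Ns hd refl (λ _ a → a)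

  resolved-lookup : ∀ 𝒜₁ 𝒜₂ x N Ns → WellFormed (𝒜₁ ++ (x , N) ∷ 𝒜₂) →
    Resolved (𝒜₁ ++ (x , N) ∷ 𝒜₂) (apps N Ns) → Resolved (𝒜₁ ++ (x , N) ∷ 𝒜₂) (apps (fvar x) Ns)
  resolved-lookup 𝒜₁ 𝒜₂ x N Ns wf (resolved h' Ns' hd same back) =
    resolved h' Ns' hd (trans same (sym (unf-lookup-apps 𝒜₁ 𝒜₂ x N Ns wf)))
             (λ b a → exi (th {𝒜₁} {𝒜₂} {x} {N} {b} {Ns}) (back b a))

  split : ∀ 𝒜 {x} → x ∈ assigned 𝒜 →
          Σ MCtx λ 𝒜₁ → Σ MCtx λ 𝒜₂ → Σ Term λ N → 𝒜 ≡ 𝒜₁ ++ (x , N) ∷ 𝒜₂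
  split 𝒜 x∈ with ∈-map⁻ proj₁ x∈
  ... | (x , N) , p∈ , refl with ∈-∃++ p∈
  ... | 𝒜₁ , 𝒜₂ , 𝒜≡ = 𝒜₁ , 𝒜₂ , N , 𝒜≡

  InScope : ℕ → MCtx → Term → Set
  InScope k 𝒜 h = ∀ y → y ∈ fv h → y ∉ assigned (drop k 𝒜)

  all-in-scope : ∀ 𝒜 h → InScope (length 𝒜) 𝒜 h
  all-in-scope 𝒜 h y _ y∈ rewrite drop-all (length 𝒜) 𝒜 ≤-refl with y∈
  ... | ()

  position-bound : ∀ k 𝒜₁ {x N 𝒜₂} → x ∉ assigned (drop k (𝒜₁ ++ (x , N) ∷ 𝒜₂)) → length 𝒜₁ < k
  position-bound zero 𝒜₁ x∉ = ⊥-elim (x∉ (∈-map⁺ proj₁ (∈-++⁺ʳ 𝒜₁ (here refl))))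
  position-bound (suc k) [] x∉ = s≤s z≤n
  position-bound (suc k) (_ ∷ 𝒜₁) x∉ = s≤s (position-bound k 𝒜₁ x∉)

  value-in-scope : ∀ 𝒜₁ {x N 𝒜₂} → WellFormed (𝒜₁ ++ (x , N) ∷ 𝒜₂) →
                   InScope (length 𝒜₁) (𝒜₁ ++ (x , N) ∷ 𝒜₂) N
  value-in-scope [] (_ , fvN , _) = fvN
  value-in-scope (_ ∷ 𝒜₁) (_ , _ , wf) = value-in-scope 𝒜₁ wf

  -- Following lookups terminates, since each one moves strictly to the left in 𝒜.
  resolve : ∀ 𝒜 → WellFormed 𝒜 → ∀ k → Acc _<_ k → ∀ h Ns → InScope k 𝒜 h → Resolved 𝒜 (apps h Ns)
  resolve 𝒜 wf k rec (app h u) Ns scope = resolve 𝒜 wf k rec h (u ∷ Ns) (λ y → scope y ∘ fv-appˡ h u)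
  resolve 𝒜 wf k (acc rec) (fvar x) Ns scope with x ∈? assigned 𝒜
  ... | dno x∉ = already Ns (free-head x∉)
  ... | dyes x∈ with split 𝒜 x∈
  ... | 𝒜₁ , 𝒜₂ , N , refl =
    resolved-lookup 𝒜₁ 𝒜₂ x N Ns wf
      (resolve _ wf (length 𝒜₁) (rec (position-bound k 𝒜₁ (scope x (here refl))))
               N Ns (value-in-scope 𝒜₁ wf))
  resolve 𝒜 wf k rec (bvar n) Ns scope = already Ns (bvar-head n)
  resolve 𝒜 wf k rec ff Ns scope = already Ns (val-head no)
  resolve 𝒜 wf k rec tt Ns scope = already Ns (val-head yes)
  resolve 𝒜 wf k rec (lam N) Ns scope = already Ns (lam-head N)
  resolve 𝒜 wf k rec (ite M₀ M₁ M₂) Ns scope = already Ns (ite-head M₀ M₁ M₂)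

  mutual
    complete : ∀ k {n b} 𝒜 h Ns → WellFormed 𝒜 → n < k →
      Eval n b (unf 𝒜 h) (map (unf 𝒜) Ns) → Accepted ∃⟦ 𝒜 ∣ b ⸴ apps h Ns ⟧
    complete (suc k) {b = b} 𝒜 h Ns wf lt d
      with resolve 𝒜 wf (length 𝒜) (<-wellFounded _) h Ns (all-in-scope 𝒜 h)
    ... | resolved h' Ns' hd same back =
      back b (complete-head k 𝒜 hd Ns' wf lt (unstack 𝒜 h' Ns' (eval-≡ (sym same) (restack 𝒜 h Ns d))))

    complete-head : ∀ k {n b h} 𝒜 → Head 𝒜 h → ∀ Ns → WellFormed 𝒜 → n < suc k →
      Eval n b (unf 𝒜 h) (map (unf 𝒜) Ns) → Accepted ∃⟦ 𝒜 ∣ b ⸴ apps h Ns ⟧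
    complete-head k 𝒜 (lam-head N) Ns wf lt d = complete-β k 𝒜 N Ns wf lt (eval-≡ (unf-lam 𝒜 N) d)
    complete-head k 𝒜 (ite-head M₀ M₁ M₂) Ns wf lt d =
      complete-ite k 𝒜 M₀ M₁ M₂ Ns wf lt (eval-≡ (unf-ite 𝒜 M₀ M₁ M₂) d)
    complete-head k 𝒜 (val-head a) Ns wf lt d = complete-val 𝒜 a Ns (eval-≡ (unf-val 𝒜 a) d)
    complete-head k 𝒜 (bvar-head n) Ns wf lt d with eval-≡ (unf-bvar 𝒜 n) d
    ... | ()
    complete-head k 𝒜 (free-head {x} x∉) Ns wf lt d
      with eval-≡ (unf-closed 𝒜 (fvar x) (λ { y (here refl) → x∉ })) d
    ... | ()

    complete-β : ∀ k {n b} 𝒜 N Ns → WellFormed 𝒜 → n < suc k →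
      Eval n b (lam (unfL 𝒜 N)) (map (unf 𝒜) Ns) → Accepted ∃⟦ 𝒜 ∣ b ⸴ apps (lam N) Ns ⟧
    complete-β k {b = b} 𝒜 N (N₁ ∷ Ns) wf (s≤s lt) (eβ {n = n} d) =
      exi (tβ {N = N} {N₁} {Ns} x'-fresh)
          (complete k (𝒜 ++ (x' , N₁) ∷ []) (sub 0 (fvar x') N) Ns (wf-β 𝒜 Ns wf x'-fresh) lt
                    (subst₂ (Eval n b) (sym (proj₁ unfolds)) (sym (proj₂ unfolds)) d))
      where
      x' = fresh 𝒜 (apps (lam N) (N₁ ∷ Ns))
      x'-fresh = fresh-Fresh 𝒜 (apps (lam N) (N₁ ∷ Ns))
      unfolds = unf-β 𝒜 Ns x'-fresh

    complete-ite : ∀ k {n b} 𝒜 M₀ M₁ M₂ Ns → WellFormed 𝒜 → n < suc k →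
      Eval n b (ite (unf 𝒜 M₀) (unf 𝒜 M₁) (unf 𝒜 M₂)) (map (unf 𝒜) Ns) →
      Accepted ∃⟦ 𝒜 ∣ b ⸴ apps (ite M₀ M₁ M₂) Ns ⟧
    complete-ite k 𝒜 M₀ M₁ M₂ Ns wf (s≤s lt) (eif₁ {n₀} {n₁} d₀ d₁) =
      exi (tif₁ {M₀ = M₀} {M₁} {M₂} {Ns}) (uni λ { _ tif'₁ → complete k 𝒜 M₀ [] wf (m⊔n<o⇒m<o n₀ n₁ lt) d₀
                      ; _ tif'₂ → complete k 𝒜 M₁ Ns wf (m⊔n<o⇒n<o n₀ n₁ lt) d₁ })
    complete-ite k 𝒜 M₀ M₁ M₂ Ns wf (s≤s lt) (eif₂ {n₀} {n₂} d₀ d₂) =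
      exi (tif₂ {M₀ = M₀} {M₁} {M₂} {Ns}) (uni λ { _ tif'₁ → complete k 𝒜 M₀ [] wf (m⊔n<o⇒m<o n₀ n₂ lt) d₀
                      ; _ tif'₂ → complete k 𝒜 M₂ Ns wf (m⊔n<o⇒n<o n₀ n₂ lt) d₂ })

    complete-val : ∀ {n b} 𝒜 a Ns → Eval n b (val a) (map (unf 𝒜) Ns) →
      Accepted ∃⟦ 𝒜 ∣ b ⸴ apps (val a) Ns ⟧
    complete-val 𝒜 yes [] eT = exi tyT acc
    complete-val 𝒜 no [] eF = exi tnF acc

open Completeness

tt-normal : Normal tt
tt-normal u ()

theorem6 : (M : Term) → Program M → (KB-accepts M ⇔ IsNormalFormOf tt M)
theorem6 M _ = mk⇔ accepted⇒normal normal⇒accepted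
  where
  accepted⇒normal : KB-accepts M → IsNormalFormOf tt M
  accepted⇒normal accepted with sound accepted _
  ... | _ , d = eval-sound d , tt-normal

  normal⇒accepted : IsNormalFormOf tt M → KB-accepts M
  normal⇒accepted (M⟶*tt , _) with eval-complete {yes} M⟶*tt
  ... | n , d = complete (suc n) [] M [] _ ≤-refl d
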